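{- Let $G$ be a finite, simple, $3$-connected graph. Then $\mathrm{mdim}(G)<2c(G)$.
   Context: For a graph with $n$ vertices and $m$ edges, the cyclomatic number is $c(G)=m-n+1$. A graph is $3$-connected if its vertex connectivity is at least $3$. For vertices $u,v$, $d(u,v)$ is the shortest-path distance; for a vertex $s$ and an edge $e=uv$, $d(s,e)=\min\{d(s,u),d(s,v)\}$. A set $S\subseteq V(G)$ is a mixed metric generator if for every two distinct elements $x,x'\in V(G)\cup E(G)$ there is $s\in S$ with $d(s,x)\neq d(s,x')$; $\mathrm{mdim}(G)$ is the minimum cardinality of a mixed metric generator. -}

module Defs where

open import Data.Nat as ℕ using (ℕ; zero; suc; _+_; _≤_; _<ᵇ_; _⊓_)
open import Data.Integer as ℤ using (ℤ)
open import Data.Bool using (Bool; true; false; T; _∧_; if_then_else_)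
open import Data.Fin using (Fin; toℕ)
open import Data.Fin.Subset using (Subset; _∈_; _∉_; ∣_∣)
open import Data.List using (List; map; allFin)
open import Data.Nat.ListAction using (sum)
open import Data.Product using (Σ; ∃; _×_; _,_)
open import Data.Unit using (⊤)
open import Relation.Nullary using (¬_)
open import Relation.Binary.PropositionalEquality using (_≡_; _≢_)

record Graph (n : ℕ) : Set where
  field
    adj   : Fin n → Fin n → Bool
    irrefl : ∀ u → adj u u ≡ false
    sym   : ∀ u v → adj u v ≡ adj v u
open Graph public

module _ {n : ℕ} (G : Graph n) where

  data WalkIn (P : Fin n → Set) : Fin n → Fin n → ℕ → Set where
    nil  : ∀ {u} → P u → WalkIn P u u 0
    cons : ∀ {u w v k} → P u → T (adj G u w) → WalkIn P w v k → WalkIn P u v (suc k)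

  Walk : Fin n → Fin n → ℕ → Set
  Walk = WalkIn (λ _ → ⊤)

  ConnectedAvoiding : Subset n → Set
  ConnectedAvoiding S = ∀ u v → u ∉ S → v ∉ S → ∃ λ k → WalkIn (λ x → x ∉ S) u v k

  ThreeConnected : Set
  ThreeConnected = 4 ≤ n × (∀ (S : Subset n) → ∣ S ∣ ≤ 2 → ConnectedAvoiding S)

  edgeCount : ℕ
  edgeCount = sum (map (λ u → sum (map (λ v →
                 if (toℕ u <ᵇ toℕ v) ∧ adj G u v then 1 else 0) (allFin n))) (allFin n))

  cyclomatic : ℤ
  cyclomatic = (ℤ.+ edgeCount ℤ.- ℤ.+ n) ℤ.+ ℤ.+ 1

  Dist : Fin n → Fin n → ℕ → Set
  Dist u v k = Walk u v k × (∀ j → Walk u v j → k ≤ j)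

  -- Elements of V(G) ∪ E(G); an edge {u,v} is represented as edge u v with u < v.
  data Elem : Set where
    vert : Fin n → Elem
    edge : Fin n → Fin n → Elem

  IsElem : Elem → Set
  IsElem (vert _)   = ⊤
  IsElem (edge u v) = (toℕ u ℕ.< toℕ v) × T (adj G u v)

  DistTo : Fin n → Elem → ℕ → Set
  DistTo s (vert v)   k = Dist s v k
  DistTo s (edge u v) k = Σ ℕ λ a → Σ ℕ λ b → Dist s u a × Dist s v b × k ≡ a ⊓ b

  MixedMetricGenerator : Subset n → Set
  MixedMetricGenerator S =
    ∀ x x' → IsElem x → IsElem x' → x ≢ x' →
      ∃ λ s → s ∈ S × (∀ k k' → DistTo s x k → DistTo s x' k' → k ≢ k')

  IsMDim : ℕ → Set
  IsMDim k = (∃ λ S → MixedMetricGenerator S × ∣ S ∣ ≡ k)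
           × (∀ S → MixedMetricGenerator S → k ≤ ∣ S ∣)

module Submission where

open import Defs
open import Data.Nat using (ℕ)
open import Data.Integer using (+_; _*_; _<_)

-- The whole vertex set is a mixed metric generator: two distinct elements of
-- V(G) ∪ E(G) are told apart by a vertex incident to exactly one of them, since
-- d(s, x) = 0 exactly when s is incident to x.  Hence mdim(G) ≤ n.  On the other
-- hand 3-connectivity forces minimum degree at least 3 (otherwise deleting the
-- neighbourhood of a vertex isolates it), so 3n ≤ 2m by the handshake lemma, and
-- then n < 2(m - n + 1) = 2c(G).

import Algebra.Properties.CommutativeMonoid.Sum as Σℕ
open import Data.Bool using (Bool; true; false; T; _∧_; if_then_else_)
open import Data.Bool.Properties using (∧-zeroʳ; ∧-identityʳ; T-≡)
open import Data.Empty using (⊥-elim)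
open import Data.Fin using (Fin; toℕ; zero; suc)
open import Data.Fin.Properties using (toℕ-injective) renaming (_≟_ to _≟ᶠ_)
open import Data.Fin.Subset using (Subset; _∈_; _∉_; _⊆_; _∩_; ∁; ⁅_⁆; ⊤; ∣_∣)
open import Data.Fin.Subset.Properties
  using (_∈?_; nonempty?; x∈p∩q⁺; x∈p∩q⁻; x∉p⇒x∈∁p; x∈∁p⇒x∉p; x∉⁅y⁆⇒x≢y;
         ∣⁅x⁆∣≡1; ∣∁p∣≡n∸∣p∣; ∣⊤∣≡n; ∈⊤; p⊆q⇒∣p∣≤∣q∣)
import Data.Integer as ℤ
import Data.Integer.Properties as ℤₚ
import Data.List as List using (map; allFin; tabulate)
import Data.List.Properties as List
open import Data.Nat as ℕ using (zero; suc; _+_; _∸_; _⊓_; _≤_; _<ᵇ_; z≤n)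
import Data.Nat.ListAction as ListAction
import Data.Nat.Properties as ℕₚ
open import Data.Product using (∃; _×_; _,_)
open import Data.Sum using (_⊎_; inj₁; inj₂)
open import Data.Unit using (tt)
import Data.Vec as Vec
import Data.Vec.Properties as Vec
open import Function using (id; _∘_; Equivalence)
open import Relation.Nullary using (¬_; Dec; yes; no; contradiction)
open import Relation.Nullary.Decidable using (_⊎-dec_)
open import Relation.Binary.PropositionalEquality as ≡
  using (_≡_; _≢_; refl; trans; cong; cong₂; subst; module ≡-Reasoning)

open Σℕ ℕₚ.+-0-commutativeMonoid using (sum-syntax; ∑-distrib-+; ∑-comm; sum-cong-≗)

𝟙 : Bool → ℕ
𝟙 b = if b then 1 else 0

sum-tabulate : ∀ {n} (f : Fin n → ℕ) → ListAction.sum (List.tabulate f) ≡ ∑[ i < n ] f i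
sum-tabulate {zero}  f = refl
sum-tabulate {suc n} f = cong (_+_ (f zero)) (sum-tabulate (f ∘ suc))

sum-map-allFin : ∀ {n} (f : Fin n → ℕ) → ListAction.sum (List.map f (List.allFin n)) ≡ ∑[ i < n ] f i
sum-map-allFin f = trans (cong ListAction.sum (List.map-tabulate id f)) (sum-tabulate f)

∑-mono-≤ : ∀ {n} {f g : Fin n → ℕ} → (∀ i → f i ≤ g i) → ∑[ i < n ] f i ≤ ∑[ i < n ] g i
∑-mono-≤ {zero}  f≤g = z≤n
∑-mono-≤ {suc n} f≤g = ℕₚ.+-mono-≤ (f≤g zero) (∑-mono-≤ (f≤g ∘ suc))

∑-const : ∀ n c → ∑[ i < n ] c ≡ n ℕ.* c
∑-const zero    c = refl
∑-const (suc n) c = cong (_+_ c) (∑-const n c)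

∣tabulate∣≡∑𝟙 : ∀ {n} (f : Fin n → Bool) → ∣ Vec.tabulate f ∣ ≡ ∑[ i < n ] 𝟙 (f i)
∣tabulate∣≡∑𝟙 {zero}  f = refl
∣tabulate∣≡∑𝟙 {suc n} f with f zero
... | true  = cong suc (∣tabulate∣≡∑𝟙 (f ∘ suc))
... | false = ∣tabulate∣≡∑𝟙 (f ∘ suc)

x∈tabulate⁺ : ∀ {n} {f : Fin n → Bool} x → T (f x) → x ∈ Vec.tabulate f
x∈tabulate⁺ {f = f} x fx = Vec.lookup⇒[]= x _ (trans (Vec.lookup∘tabulate f x) (Equivalence.to T-≡ fx))

x∈tabulate⁻ : ∀ {n} {f : Fin n → Bool} x → x ∈ Vec.tabulate f → f x ≡ true
x∈tabulate⁻ {f = f} x x∈ = trans (≡.sym (Vec.lookup∘tabulate f x)) (Vec.[]=⇒lookup x∈)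

∣p∣<∣q∣⇒∃∈q∉p : ∀ {n} (p q : Subset n) → ∣ p ∣ ℕ.< ∣ q ∣ → ∃ λ x → x ∈ q × x ∉ p
∣p∣<∣q∣⇒∃∈q∉p p q ∣p∣<∣q∣ with nonempty? (q ∩ ∁ p)
... | yes (x , x∈q∩∁p) = let x∈q , x∈∁p = x∈p∩q⁻ q (∁ p) x∈q∩∁p in x , x∈q , x∈∁p⇒x∉p x∈∁p
... | no q∩∁p-empty = contradiction (p⊆q⇒∣p∣≤∣q∣ q⊆p) (ℕₚ.<⇒≱ ∣p∣<∣q∣)
  where
  q⊆p : q ⊆ p
  q⊆p {x} x∈q with x ∈? p
  ... | yes x∈p = x∈p
  ... | no  x∉p = contradiction (x , x∈p∩q⁺ (x∈q , x∉p⇒x∈∁p x∉p)) q∩∁p-empty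

<ᵇ-xor : ∀ {m n} → m ≢ n → 𝟙 (m <ᵇ n) + 𝟙 (n <ᵇ m) ≡ 1
<ᵇ-xor {zero}  {zero}  0≢0 = contradiction refl 0≢0
<ᵇ-xor {zero}  {suc n} _   = refl
<ᵇ-xor {suc m} {zero}  _   = refl
<ᵇ-xor {suc m} {suc n} m≢n = <ᵇ-xor (m≢n ∘ cong suc)

module _ {n : ℕ} (G : Graph n) where

  adjacent⇒≢ : ∀ {u v} → adj G u v ≡ true → u ≢ v
  adjacent⇒≢ {u} u~u refl with trans (≡.sym u~u) (irrefl G u)
  ... | ()

  neighbourhood : Fin n → Subset n
  neighbourhood v = Vec.tabulate (adj G v)

  degree : Fin n → ℕ
  degree v = ∣ neighbourhood v ∣

  v∉neighbourhood[v] : ∀ v → v ∉ neighbourhood v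
  v∉neighbourhood[v] v v∈N = adjacent⇒≢ (x∈tabulate⁻ v v∈N) refl

  walkIn-head : ∀ {P u v k} → WalkIn G P u v k → P u
  walkIn-head (nil Pu)      = Pu
  walkIn-head (cons Pu _ _) = Pu

  walk-avoiding-neighbourhood⇒≡ : ∀ {v w k} → WalkIn G (_∉ neighbourhood v) v w k → v ≡ w
  walk-avoiding-neighbourhood⇒≡ (nil _)            = refl
  walk-avoiding-neighbourhood⇒≡ (cons _ v~u u⇝w) = contradiction (x∈tabulate⁺ _ v~u) (walkIn-head u⇝w)

  ThreeConnected⇒3≤degree : ThreeConnected G → ∀ v → 3 ≤ degree v
  ThreeConnected⇒3≤degree (4≤n , connected) v = ℕₚ.≮⇒≥ λ degree<3 →
    let w , w∈∁⁅v⁆ , w∉N = ∣p∣<∣q∣⇒∃∈q∉p (neighbourhood v) (∁ ⁅ v ⁆) (ℕₚ.<-≤-trans degree<3 3≤∣∁⁅v⁆∣)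
        _ , v⇝w = connected (neighbourhood v) (ℕₚ.≤-pred degree<3) v w (v∉neighbourhood[v] v) w∉N
    in x∉⁅y⁆⇒x≢y (x∈∁p⇒x∉p w∈∁⁅v⁆) (≡.sym (walk-avoiding-neighbourhood⇒≡ v⇝w))
    where
    3≤∣∁⁅v⁆∣ : 3 ≤ ∣ ∁ ⁅ v ⁆ ∣
    3≤∣∁⁅v⁆∣ = subst (3 ≤_) (≡.sym (trans (∣∁p∣≡n∸∣p∣ ⁅ v ⁆) (cong (n ∸_) (∣⁅x⁆∣≡1 v))))
                 (ℕₚ.∸-monoˡ-≤ 1 4≤n)

  orientedEdge : Fin n → Fin n → ℕ
  orientedEdge u v = 𝟙 ((toℕ u <ᵇ toℕ v) ∧ adj G u v)

  𝟙adj≡orientedEdge+orientedEdge : ∀ u v → 𝟙 (adj G u v) ≡ orientedEdge u v + orientedEdge v u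
  𝟙adj≡orientedEdge+orientedEdge u v rewrite Graph.sym G v u with adj G u v in u~v
  ... | false = ≡.sym (cong₂ _+_ (cong 𝟙 (∧-zeroʳ (toℕ u <ᵇ toℕ v))) (cong 𝟙 (∧-zeroʳ (toℕ v <ᵇ toℕ u))))
  ... | true  = ≡.sym (trans (cong₂ _+_ (cong 𝟙 (∧-identityʳ (toℕ u <ᵇ toℕ v)))
                                         (cong 𝟙 (∧-identityʳ (toℕ v <ᵇ toℕ u))))
                             (<ᵇ-xor (adjacent⇒≢ u~v ∘ toℕ-injective)))

  edgeCount≡∑∑orientedEdge : edgeCount G ≡ ∑[ u < n ] ∑[ v < n ] orientedEdge u v
  edgeCount≡∑∑orientedEdge =
    trans (sum-map-allFin (λ u → ListAction.sum (List.map (orientedEdge u) (List.allFin n))))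
          (sum-cong-≗ (sum-map-allFin ∘ orientedEdge))

  ∑degree≡2*edgeCount : ∑[ v < n ] degree v ≡ 2 ℕ.* edgeCount G
  ∑degree≡2*edgeCount = begin
    ∑[ u < n ] degree u
      ≡⟨ sum-cong-≗ (∣tabulate∣≡∑𝟙 ∘ adj G) ⟩
    ∑[ u < n ] ∑[ v < n ] 𝟙 (adj G u v)
      ≡⟨ sum-cong-≗ (λ u → sum-cong-≗ (𝟙adj≡orientedEdge+orientedEdge u)) ⟩
    ∑[ u < n ] ∑[ v < n ] (orientedEdge u v + orientedEdge v u)
      ≡⟨ sum-cong-≗ (λ u → ∑-distrib-+ (orientedEdge u) (λ v → orientedEdge v u)) ⟩
    ∑[ u < n ] (∑[ v < n ] orientedEdge u v + ∑[ v < n ] orientedEdge v u)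
      ≡⟨ ∑-distrib-+ (λ u → ∑[ v < n ] orientedEdge u v) (λ u → ∑[ v < n ] orientedEdge v u) ⟩
    m + ∑[ u < n ] ∑[ v < n ] orientedEdge v u
      ≡⟨ cong (_+_ m) (∑-comm (λ u v → orientedEdge v u)) ⟩
    m + m
      ≡⟨ cong (λ e → e + e) edgeCount≡∑∑orientedEdge ⟨
    edgeCount G + edgeCount G
      ≡⟨ cong (_+_ (edgeCount G)) (ℕₚ.+-identityʳ (edgeCount G)) ⟨
    2 ℕ.* edgeCount G ∎
    where
    open ≡-Reasoning
    m = ∑[ u < n ] ∑[ v < n ] orientedEdge u v

  ThreeConnected⇒3n≤2m : ThreeConnected G → 3 ℕ.* n ≤ 2 ℕ.* edgeCount G
  ThreeConnected⇒3n≤2m tc = begin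
    3 ℕ.* n              ≡⟨ ℕₚ.*-comm 3 n ⟩
    n ℕ.* 3              ≡⟨ ∑-const n 3 ⟨
    ∑[ v < n ] 3         ≤⟨ ∑-mono-≤ (ThreeConnected⇒3≤degree tc) ⟩
    ∑[ v < n ] degree v  ≡⟨ ∑degree≡2*edgeCount ⟩
    2 ℕ.* edgeCount G    ∎
    where open ℕₚ.≤-Reasoning

  Incident : Fin n → Elem G → Set
  Incident s (vert v)   = s ≡ v
  Incident s (edge u v) = s ≡ u ⊎ s ≡ v

  incident? : ∀ s x → Dec (Incident s x)
  incident? s (vert v)   = s ≟ᶠ v
  incident? s (edge u v) = s ≟ᶠ u ⊎-dec s ≟ᶠ v

  Dist-self : ∀ {s k} → Dist G s s k → k ≡ 0
  Dist-self (_ , minimal) = ℕₚ.n≤0⇒n≡0 (minimal 0 (nil tt))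

  Walk-length0⇒≡ : ∀ {s v} → Walk G s v 0 → s ≡ v
  Walk-length0⇒≡ (nil _) = refl

  Incident⇒DistTo≡0 : ∀ {s k} x → Incident s x → DistTo G s x k → k ≡ 0
  Incident⇒DistTo≡0 (vert v)   refl        d                         = Dist-self d
  Incident⇒DistTo≡0 (edge u v) (inj₁ refl) (a , b , du , _ , k≡a⊓b)  =
    trans k≡a⊓b (cong (_⊓ b) (Dist-self du))
  Incident⇒DistTo≡0 (edge u v) (inj₂ refl) (a , b , _ , dv , k≡a⊓b)  =
    trans k≡a⊓b (trans (cong (a ⊓_) (Dist-self dv)) (ℕₚ.⊓-zeroʳ a))

  DistTo≡0⇒Incident : ∀ {s} x → DistTo G s x 0 → Incident s x
  DistTo≡0⇒Incident (vert v)   (s⇝v , _)                         = Walk-length0⇒≡ s⇝v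
  DistTo≡0⇒Incident (edge u v) (zero  , _     , (s⇝u , _) , _)   = inj₁ (Walk-length0⇒≡ s⇝u)
  DistTo≡0⇒Incident (edge u v) (suc _ , zero  , _ , (s⇝v , _) , _) = inj₂ (Walk-length0⇒≡ s⇝v)
  DistTo≡0⇒Incident (edge u v) (suc _ , suc _ , _ , _ , ())

  Resolves : Fin n → Elem G → Elem G → Set
  Resolves s x x' = ∀ k k' → DistTo G s x k → DistTo G s x' k' → k ≢ k'

  incident-to-one⇒Resolves : ∀ {s} x x' → Incident s x → ¬ Incident s x' → Resolves s x x'
  incident-to-one⇒Resolves x x' s∼x s≁x' k k' dx dx' k≡k' =
    s≁x' (DistTo≡0⇒Incident x' (subst (DistTo G _ x') (trans (≡.sym k≡k') (Incident⇒DistTo≡0 x s∼x dx)) dx'))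

  Resolves-sym : ∀ {s} x x' → Resolves s x' x → Resolves s x x'
  Resolves-sym x x' resolves k k' dx dx' k≡k' = resolves k' k dx' dx (≡.sym k≡k')

  <⇒≢ : ∀ {u v : Fin n} → toℕ u ℕ.< toℕ v → u ≢ v
  <⇒≢ u<v refl = ℕₚ.<-irrefl refl u<v

  SeparatedByIncidence : Fin n → Elem G → Elem G → Set
  SeparatedByIncidence s x x' = (Incident s x × ¬ Incident s x') ⊎ (¬ Incident s x × Incident s x')

  distinct⇒∃SeparatedByIncidence : ∀ x x' → IsElem G x → IsElem G x' → x ≢ x' →
                                    ∃ λ s → SeparatedByIncidence s x x'
  distinct⇒∃SeparatedByIncidence (vert a) x' _ _ x≢x' with incident? a x'
  ... | no a≁x' = a , inj₁ (refl , a≁x')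
  distinct⇒∃SeparatedByIncidence (vert a) (vert b) _ _ x≢x' | yes refl = ⊥-elim (x≢x' refl)
  distinct⇒∃SeparatedByIncidence (vert a) (edge u v) _ (u<v , _) _ | yes (inj₁ refl) =
    v , inj₂ (<⇒≢ u<v ∘ ≡.sym , inj₂ refl)
  distinct⇒∃SeparatedByIncidence (vert a) (edge u v) _ (u<v , _) _ | yes (inj₂ refl) =
    u , inj₂ (<⇒≢ u<v , inj₁ refl)
  distinct⇒∃SeparatedByIncidence (edge u v) x' (u<v , _) _ _ with incident? u x' | incident? v x'
  ... | no u≁x' | _       = u , inj₁ (inj₁ refl , u≁x')
  ... | yes _   | no v≁x' = v , inj₁ (inj₂ refl , v≁x')
  distinct⇒∃SeparatedByIncidence (edge u v) (vert b) (u<v , _) _ _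
    | yes refl | yes refl = ⊥-elim (<⇒≢ u<v refl)
  distinct⇒∃SeparatedByIncidence (edge u v) (edge p q) (u<v , _) _ _
    | yes (inj₁ refl) | yes (inj₁ refl) = ⊥-elim (<⇒≢ u<v refl)
  distinct⇒∃SeparatedByIncidence (edge u v) (edge p q) _ _ x≢x'
    | yes (inj₁ refl) | yes (inj₂ refl) = ⊥-elim (x≢x' refl)
  distinct⇒∃SeparatedByIncidence (edge u v) (edge p q) (u<v , _) (p<q , _) _
    | yes (inj₂ refl) | yes (inj₁ refl) = ⊥-elim (ℕₚ.<-asym u<v p<q)
  distinct⇒∃SeparatedByIncidence (edge u v) (edge p q) (u<v , _) _ _
    | yes (inj₂ refl) | yes (inj₂ refl) = ⊥-elim (<⇒≢ u<v refl)

  ⊤-isMixedMetricGenerator : MixedMetricGenerator G ⊤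
  ⊤-isMixedMetricGenerator x x' x-valid x'-valid x≢x'
    with distinct⇒∃SeparatedByIncidence x x' x-valid x'-valid x≢x'
  ... | s , inj₁ (s∼x , s≁x') = s , ∈⊤ , incident-to-one⇒Resolves x x' s∼x s≁x'
  ... | s , inj₂ (s≁x , s∼x') = s , ∈⊤ , Resolves-sym x x' (incident-to-one⇒Resolves x' x s∼x' s≁x)

  IsMDim⇒≤n : ∀ {k} → IsMDim G k → k ≤ n
  IsMDim⇒≤n (_ , minimal) = subst (_ ≤_) (∣⊤∣≡n n) (minimal ⊤ ⊤-isMixedMetricGenerator)

[+m-+n]+1≡+[m∸n+1] : ∀ {m n} → n ≤ m → (+ m ℤ.- + n) ℤ.+ + 1 ≡ + (m ∸ n + 1)
[+m-+n]+1≡+[m∸n+1] {m} {n} n≤m = cong (ℤ._+ + 1) (trans (ℤₚ.[+m]-[+n]≡m⊖n m n) (ℤₚ.⊖-≥ n≤m))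

3n≤2m⇒n<2[m∸n+1] : ∀ {m n} → 3 ℕ.* n ≤ 2 ℕ.* m → n ℕ.< 2 ℕ.* (m ∸ n + 1)
3n≤2m⇒n<2[m∸n+1] {m} {n} 3n≤2m = begin-strict
  -- 3 * n unfolds definitionally to n + 2 * n
  n                    ≤⟨ ℕₚ.m+n≤o⇒m≤o∸n n 3n≤2m ⟩
  2 ℕ.* m ∸ 2 ℕ.* n    ≡⟨ ℕₚ.*-distribˡ-∸ 2 m n ⟨
  2 ℕ.* (m ∸ n)        <⟨ ℕₚ.m<m+n _ (ℕ.s≤s z≤n) ⟩
  2 ℕ.* (m ∸ n) + 2    ≡⟨ ℕₚ.*-distribˡ-+ 2 (m ∸ n) 1 ⟨
  2 ℕ.* (m ∸ n + 1)    ∎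
  where open ℕₚ.≤-Reasoning

3n≤2m⇒n≤m : ∀ {m n} → 3 ℕ.* n ≤ 2 ℕ.* m → n ≤ m
3n≤2m⇒n≤m {m} {n} 3n≤2m = ℕₚ.*-cancelˡ-≤ 2 (ℕₚ.≤-trans (ℕₚ.*-monoˡ-≤ n (ℕₚ.n≤1+n 2)) 3n≤2m)

mainTheorem9 : ∀ {n : ℕ} (G : Graph n) → ThreeConnected G →
    ∀ (k : ℕ) → IsMDim G k → + k < + 2 * cyclomatic G
mainTheorem9 {n} G tc k mdim = begin-strict
  + k                          <⟨ ℤ.+<+ (ℕₚ.≤-<-trans (IsMDim⇒≤n G mdim) (3n≤2m⇒n<2[m∸n+1] {m} {n} 3n≤2m)) ⟩
  + (2 ℕ.* (m ∸ n + 1))        ≡⟨ ℤₚ.pos-* 2 (m ∸ n + 1) ⟩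
  + 2 * + (m ∸ n + 1)          ≡⟨ cong (+ 2 *_) ([+m-+n]+1≡+[m∸n+1] (3n≤2m⇒n≤m {m} {n} 3n≤2m)) ⟨
  + 2 * cyclomatic G           ∎
  where
  open ℤₚ.≤-Reasoning
  m = edgeCount G
  3n≤2m = ThreeConnected⇒3n≤2m G tc
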